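{- Let $d\ge 3$ and let $G_d$ be the $d$-th silo graph. Then: (a) for every $i\in[d-1]\setminus\{2\}$ there is a path of length $d-2$ in $G_d$ from $(1,2)$ to $(i,d)$, and there is a path of length $d-2$ from $(1,2)$ to $(d,d-1)$; (b) for each $2\le i\le d-1$ there is a path of length $d-2$ from $(i,1)$ to $(i,d)$, and there is a path of length $d-2$ from $(d,1)$ to $(d,d-1)$; (c) every vertex of $G_d$ has distance at most $d-2$ from some vertex in $\{(1,2)\}\cup\{(i,1): 2\le i\le d\}$; (d) any two vertices in $\{(1,2)\}\cup\{(i,1):2\le i\le d\}$ have distance at most $3$ in $G_d$.
   Context: The $d$-th silo graph $G_d$ has vertex set $\{(a,b)\in[d]^2 : a\ne b\}$, and two distinct vertices $(a,b),(a',b')$ with $b\le b'$ are adjacent iff $b=b'$; or $b'=b+1$, $a=a'$ and $b\ne a-1$; or $b'=b+2$, $a=a'$ and $b=a-1$. -}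

module Defs where

open import Data.Nat using (ℕ; zero; suc; _+_; _∸_; _≤_)
open import Data.Product using (Σ; _×_; _,_; ∃-syntax)
open import Data.Sum using (_⊎_)
open import Data.Fin using (Fin; fromℕ; inject₁) renaming (zero to fzero; suc to fsuc)
open import Function.Definitions using (Injective)
open import Relation.Binary.PropositionalEquality using (_≡_; _≢_)

V : Set
V = ℕ × ℕ

IsVertex : ℕ → V → Set
IsVertex d (a , b) = (1 ≤ a × a ≤ d) × (1 ≤ b × b ≤ d) × a ≢ b

-- The ordered adjacency condition, for (a,b),(a',b') with b ≤ b'.
-- (a ≥ 1 for vertices, so a ∸ 1 is the ordinary a - 1.)
AdjOrd : V → V → Set
AdjOrd (a , b) (a' , b') =
  b ≤ b' ×
  ( b ≡ b'
  ⊎ (b' ≡ b + 1 × a ≡ a' × b ≢ a ∸ 1)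
  ⊎ (b' ≡ b + 2 × a ≡ a' × b ≡ a ∸ 1))

Adj : ℕ → V → V → Set
Adj d u v = IsVertex d u × IsVertex d v × u ≢ v × (AdjOrd u v ⊎ AdjOrd v u)

record Path (d k : ℕ) (u v : V) : Set where
  field
    vert  : Fin (suc k) → V
    start : vert fzero ≡ u
    end   : vert (fromℕ k) ≡ v
    isV   : ∀ i → IsVertex d (vert i)
    adj   : ∀ (i : Fin k) → Adj d (vert (inject₁ i)) (vert (fsuc i))
    inj   : Injective _≡_ _≡_ vert

DistLe : ℕ → V → V → ℕ → Set
DistLe d u v k = ∃[ m ] (m ≤ k × Path d m u v)

InS : ℕ → V → Set
InS d s = s ≡ (1 , 2) ⊎ ∃[ i ] ((2 ≤ i × i ≤ d) × s ≡ (i , 1))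

-- For a ≥ 1 the vertices of row a, ordered by second coordinate, form a path of
-- length d − 2 in G_d: consecutive second coordinates differ by 1, except that the
-- value a is jumped over from a − 1 to a + 1, which is exactly the third adjacency
-- clause. Every column is a clique. Parts (a) and (b) walk along a row (in (a) after
-- one step inside column 2); (c) walks along row a from its first vertex, which is
-- (1 , 2) when a = 1 and (a , 1) otherwise; (d) uses (i , 1) — (3 , 1) — (3 , 2) — (1 , 2)
-- and the fact that paths can be reversed.

module Submission where

open import Defs
open import Data.Nat using (ℕ; zero; suc; _+_; _∸_; _≤_; _<_; _≟_; z≤n; s≤s; s≤s⁻¹; z<s)
open import Data.Nat.Properties
  using (≤-refl; ≤-trans; n≤1+n; m≤m+n; +-monoʳ-≤; +-suc; +-identityʳ; +-comm; +-cancelˡ-≡; ∸-monoˡ-≤; suc-injective; <⇒≢; ≤⇒≯; <-cmp)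
open import Data.Fin using (Fin; toℕ; fromℕ; inject₁; opposite) renaming (zero to fzero; suc to fsuc)
open import Data.Fin.Properties using (toℕ<n; toℕ-fromℕ; toℕ-inject₁; toℕ-injective; opposite-involutive)
open import Data.Product using (_×_; _,_; proj₁; proj₂; ∃-syntax)
open import Data.Sum using (_⊎_; inj₁; inj₂; swap)
open import Data.Empty using (⊥-elim)
open import Relation.Binary using (tri<; tri≈; tri>)
open import Relation.Binary.PropositionalEquality using (_≡_; _≢_; refl; sym; trans; cong; subst)
open import Relation.Nullary using (yes; no)

Adj-sym : ∀ {d u v} → Adj d u v → Adj d v u
Adj-sym (hu , hv , u≢v , ord) = hv , hu , (λ eq → u≢v (sym eq)) , swap ord

Adj-sameColumn : ∀ {d a a' b} → IsVertex d (a , b) → IsVertex d (a' , b) → a ≢ a' →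
                 Adj d (a , b) (a' , b)
Adj-sameColumn ha ha' a≢a' = ha , ha' , (λ eq → a≢a' (cong proj₁ eq)) , inj₁ (≤-refl , inj₁ refl)

emptyPath : ∀ {d u} → IsVertex d u → Path d 0 u u
emptyPath {d} {u} hu = record
  { vert = λ _ → u ; start = refl ; end = refl ; isV = λ _ → hu ; adj = λ () ; inj = inj }
  where
  inj : ∀ {i j : Fin 1} → u ≡ u → i ≡ j
  inj {fzero} {fzero} _ = refl

cons : ∀ {d k w v} (u : V) → IsVertex d u → Adj d u w → (P : Path d k w v) →
       (∀ i → Path.vert P i ≢ u) → Path d (suc k) u v
cons {d} {k} u hu u~w P fresh = record
  { vert = vert ; start = refl ; end = Path.end P ; isV = isV ; adj = adj ; inj = inj }
  where
  vert : Fin (suc (suc k)) → V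
  vert fzero    = u
  vert (fsuc i) = Path.vert P i
  isV : ∀ i → IsVertex d (vert i)
  isV fzero    = hu
  isV (fsuc i) = Path.isV P i
  adj : ∀ (i : Fin (suc k)) → Adj d (vert (inject₁ i)) (vert (fsuc i))
  adj fzero    = subst (Adj d u) (sym (Path.start P)) u~w
  adj (fsuc i) = Path.adj P i
  inj : ∀ {i j} → vert i ≡ vert j → i ≡ j
  inj {fzero}  {fzero}  _  = refl
  inj {fzero}  {fsuc j} eq = ⊥-elim (fresh j (sym eq))
  inj {fsuc i} {fzero}  eq = ⊥-elim (fresh i eq)
  inj {fsuc i} {fsuc j} eq = cong fsuc (Path.inj P eq)

opposite-fromℕ : ∀ k → opposite (fromℕ k) ≡ fzero
opposite-fromℕ zero    = refl
opposite-fromℕ (suc k) = cong inject₁ (opposite-fromℕ k)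

opposite-inject₁ : ∀ {k} (i : Fin k) → opposite (inject₁ i) ≡ fsuc (opposite i)
opposite-inject₁ {suc k} fzero = refl
opposite-inject₁ (fsuc i)      = cong inject₁ (opposite-inject₁ i)

reverse : ∀ {d k u v} → Path d k u v → Path d k v u
reverse {d} {k} {u} P = record
  { vert  = λ i → vert (opposite i)
  ; start = Path.end P
  ; end   = subst (λ i → vert i ≡ u) (sym (opposite-fromℕ k)) (Path.start P)
  ; isV   = λ i → Path.isV P (opposite i)
  ; adj   = adj
  ; inj   = λ {i} {j} eq → trans (sym (opposite-involutive i))
                             (trans (cong opposite (Path.inj P eq)) (opposite-involutive j))
  }
  where
  open Path P using (vert)
  adj : ∀ (i : Fin k) → Adj d (vert (opposite (inject₁ i))) (vert (opposite (fsuc i)))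
  adj i = subst (λ j → Adj d (vert j) (vert (inject₁ (opposite i))))
                (sym (opposite-inject₁ i)) (Adj-sym (Path.adj P (opposite i)))

pathFromℕ : ∀ {d} k (f : ℕ → V) {u v} → f 0 ≡ u → f k ≡ v →
            (∀ j → j ≤ k → IsVertex d (f j)) → (∀ j → j < k → Adj d (f j) (f (suc j))) →
            (∀ i j → f i ≡ f j → i ≡ j) → Path d k u v
pathFromℕ {d} k f {v = v} f0 fk isV adj inj = record
  { vert  = λ i → f (toℕ i)
  ; start = f0
  ; end   = subst (λ x → f x ≡ v) (sym (toℕ-fromℕ k)) fk
  ; isV   = λ i → isV (toℕ i) (s≤s⁻¹ (toℕ<n i))
  ; adj   = λ i → subst (λ x → Adj d (f x) (f (suc (toℕ i)))) (sym (toℕ-inject₁ i))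
                        (adj (toℕ i) (toℕ<n i))
  ; inj   = λ eq → toℕ-injective (inj _ _ eq)
  }

-- skip a enumerates ℕ ∖ {a} increasingly, so for a ≥ 1 row a of G_d is the path
-- (a , skip a 1) , … , (a , skip a (d ∸ 1)).
skip : ℕ → ℕ → ℕ
skip zero    p       = suc p
skip (suc a) zero    = zero
skip (suc a) (suc p) = suc (skip a p)

skip-≢ : ∀ a p → skip a p ≢ a
skip-≢ zero    p       ()
skip-≢ (suc a) zero    ()
skip-≢ (suc a) (suc p) eq = skip-≢ a p (suc-injective eq)

skip-injective : ∀ a {p q} → skip a p ≡ skip a q → p ≡ q
skip-injective zero    eq = suc-injective eq
skip-injective (suc a) {zero}  {zero}  eq = refl
skip-injective (suc a) {suc p} {suc q} eq = cong suc (skip-injective a (suc-injective eq))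

p≤skip : ∀ a p → p ≤ skip a p
p≤skip zero    p       = n≤1+n p
p≤skip (suc a) zero    = z≤n
p≤skip (suc a) (suc p) = s≤s (p≤skip a p)

skip≤1+p : ∀ a p → skip a p ≤ suc p
skip≤1+p zero    p       = ≤-refl
skip≤1+p (suc a) zero    = z≤n
skip≤1+p (suc a) (suc p) = s≤s (skip≤1+p a p)

skip-< : ∀ {a p} → p < a → skip a p ≡ p
skip-< {suc a} {zero}  _         = refl
skip-< {suc a} {suc p} (s≤s p<a) = cong suc (skip-< p<a)

skip-≥ : ∀ {a p} → a ≤ p → skip a p ≡ suc p
skip-≥ {zero}          _         = refl
skip-≥ {suc a} {suc p} (s≤s a≤p) = cong suc (skip-≥ a≤p)

-- The gap of skip a sits exactly where the third clause of AdjOrd allows a jump by 2.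
skip-suc : ∀ a p → (skip a (suc p) ≡ skip a p + 1 × skip a p ≢ a ∸ 1)
                 ⊎ (skip a (suc p) ≡ skip a p + 2 × skip a p ≡ a ∸ 1)
skip-suc zero          p       = inj₁ (cong suc (+-comm 1 p) , λ ())
skip-suc (suc zero)    zero    = inj₂ (refl , refl)
skip-suc (suc (suc a)) zero    = inj₁ (refl , λ ())
skip-suc (suc zero)    (suc p) = inj₁ (cong (λ x → suc (suc x)) (+-comm 1 p) , λ ())
skip-suc (suc (suc a)) (suc p) with skip-suc (suc a) p
... | inj₁ (step , ne) = inj₁ (cong suc step , λ eq → ne (suc-injective eq))
... | inj₂ (step , eq) = inj₂ (cong suc step , cong suc eq)

module _ {d a : ℕ} (1≤a : 1 ≤ a) (a≤d : a ≤ d) where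

  row-vertex : ∀ {p} → 1 ≤ p → suc p ≤ d → IsVertex d (a , skip a p)
  row-vertex {p} 1≤p p<d =
    (1≤a , a≤d) , (≤-trans 1≤p (p≤skip a p) , ≤-trans (skip≤1+p a p) p<d) , λ eq → skip-≢ a p (sym eq)

  row-adj : ∀ {p} → 1 ≤ p → suc (suc p) ≤ d → Adj d (a , skip a p) (a , skip a (suc p))
  row-adj {p} 1≤p 1+p<d =
    row-vertex 1≤p (≤-trans (n≤1+n _) 1+p<d) , row-vertex (≤-trans 1≤p (n≤1+n p)) 1+p<d ,
    (λ eq → <⇒≢ ≤-refl (skip-injective a (cong proj₂ eq))) , inj₁ ordered
    where
    ordered : AdjOrd (a , skip a p) (a , skip a (suc p))
    ordered with skip-suc a p
    ... | inj₁ (step , ne) = subst (skip a p ≤_) (sym step) (m≤m+n _ 1) , inj₂ (inj₁ (step , refl , ne))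
    ... | inj₂ (step , eq) = subst (skip a p ≤_) (sym step) (m≤m+n _ 2) , inj₂ (inj₂ (step , refl , eq))

  rowPath : ∀ s k {b} → 1 ≤ s → suc (s + k) ≤ d → skip a (s + k) ≡ b →
            Path d k (a , skip a s) (a , b)
  rowPath s k 1≤s s+k<d end =
    pathFromℕ k (λ j → a , skip a (s + j)) (cong (λ x → a , skip a x) (+-identityʳ s))
              (cong (a ,_) end) isV adj inj
    where
    1≤s+ : ∀ j → 1 ≤ s + j
    1≤s+ j = ≤-trans 1≤s (m≤m+n s j)
    isV : ∀ j → j ≤ k → IsVertex d (a , skip a (s + j))
    isV j j≤k = row-vertex (1≤s+ j) (≤-trans (s≤s (+-monoʳ-≤ s j≤k)) s+k<d)
    adj : ∀ j → j < k → Adj d (a , skip a (s + j)) (a , skip a (s + suc j))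
    adj j j<k = subst (λ x → Adj d (a , skip a (s + j)) (a , skip a x)) (sym (+-suc s j))
                  (row-adj (1≤s+ j) (subst (λ x → suc x ≤ d) (+-suc s j)
                                           (≤-trans (s≤s (+-monoʳ-≤ s j<k)) s+k<d)))
    inj : ∀ i j → (a , skip a (s + i)) ≡ (a , skip a (s + j)) → i ≡ j
    inj i j eq = +-cancelˡ-≡ s i j (skip-injective a (cong proj₂ eq))

  rowDist : ∀ {b} → 1 ≤ b → b ≤ d → a ≢ b → DistLe d (a , skip a 1) (a , b) (d ∸ 2)
  rowDist {b} 1≤b b≤d a≢b with <-cmp b a
  rowDist {suc b} _ _ _ | tri< b<a _ _ =
    b , ∸-monoˡ-≤ 2 (≤-trans b<a a≤d) , rowPath 1 b (s≤s z≤n) (≤-trans b<a a≤d) (skip-< b<a)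
  ... | tri≈ _ b≡a _ = ⊥-elim (a≢b (sym b≡a))
  rowDist {suc zero} _ _ _ | tri> _ _ a<1 = ⊥-elim (≤⇒≯ 1≤a a<1)
  rowDist {suc (suc b)} _ b≤d _ | tri> _ _ a<b =
    b , ∸-monoˡ-≤ 2 b≤d , rowPath 1 b (s≤s z≤n) b≤d (skip-≥ (s≤s⁻¹ a<b))

DistLe-sym : ∀ {d u v k} → DistLe d u v k → DistLe d v u k
DistLe-sym (m , m≤k , P) = m , m≤k , reverse P

module SiloGraph (e : ℕ) where

  D : ℕ
  D = 3 + e

  vertex : ∀ {a b} → 1 ≤ a → a ≤ D → 1 ≤ b → b ≤ D → a ≢ b → IsVertex D (a , b)
  vertex 1≤a a≤D 1≤b b≤D a≢b = (1≤a , a≤D) , (1≤b , b≤D) , a≢b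

  3≤D : 3 ≤ D
  3≤D = s≤s (s≤s z<s)

  vertex-12 : IsVertex D (1 , 2)
  vertex-12 = vertex z<s z<s z<s (s≤s z<s) (λ ())

  vertex-i2 : ∀ {i} → 3 ≤ i → i ≤ D → IsVertex D (i , 2)
  vertex-i2 (s≤s (s≤s (s≤s z≤n))) i≤D = vertex z<s i≤D z<s (s≤s z<s) (λ ())

  vertex-i1 : ∀ {i} → 2 ≤ i → i ≤ D → IsVertex D (i , 1)
  vertex-i1 (s≤s (s≤s z≤n)) i≤D = vertex z<s i≤D z<s z<s (λ ())

  -- For i ≥ 3 the path enters row i at (i , 2) = (i , skip i 2).
  path-from-12-to-top : ∀ i → 1 ≤ i → i ≤ D ∸ 1 → i ≢ 2 → Path D (D ∸ 2) (1 , 2) (i , D)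
  path-from-12-to-top 1 _ _ _ = rowPath z<s z<s 1 (1 + e) z<s ≤-refl refl
  path-from-12-to-top 2 _ _ i≢2 = ⊥-elim (i≢2 refl)
  path-from-12-to-top i@(suc (suc (suc _))) _ i<D _ =
    cons (1 , 2) vertex-12 (Adj-sameColumn vertex-12 (vertex-i2 (s≤s (s≤s z<s)) i≤D) (λ ()))
         (rowPath z<s i≤D 2 e z<s ≤-refl (skip-≥ i<D)) (λ _ ())
    where i≤D = ≤-trans i<D (n≤1+n _)

  path-from-12-to-last-row : Path D (D ∸ 2) (1 , 2) (D , D ∸ 1)
  path-from-12-to-last-row =
    cons (1 , 2) vertex-12 (Adj-sameColumn vertex-12 (vertex-i2 3≤D ≤-refl) (λ ()))
         (rowPath z<s ≤-refl 2 e z<s ≤-refl (skip-< ≤-refl)) (λ _ ())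

  path-up-row : ∀ i → 2 ≤ i → i ≤ D ∸ 1 → Path D (D ∸ 2) (i , 1) (i , D)
  path-up-row 1 (s≤s ()) _
  path-up-row i@(suc (suc _)) _ i<D =
    rowPath z<s (≤-trans i<D (n≤1+n _)) 1 (1 + e) z<s ≤-refl (skip-≥ i<D)

  path-up-last-row : Path D (D ∸ 2) (D , 1) (D , D ∸ 1)
  path-up-last-row = rowPath z<s ≤-refl 1 (1 + e) z<s ≤-refl (skip-< ≤-refl)

  InS-dominating : ∀ v → IsVertex D v → ∃[ s ] (InS D s × DistLe D s v (D ∸ 2))
  InS-dominating (1 , b) ((1≤a , a≤D) , (1≤b , b≤D) , a≢b) =
    (1 , 2) , inj₁ refl , rowDist 1≤a a≤D 1≤b b≤D a≢b
  InS-dominating (a@(suc (suc _)) , b) ((1≤a , a≤D) , (1≤b , b≤D) , a≢b) =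
    (a , 1) , inj₂ (a , (s≤s z<s , a≤D) , refl) , rowDist 1≤a a≤D 1≤b b≤D a≢b

  path-31-to-12 : Path D 2 (3 , 1) (1 , 2)
  path-31-to-12 =
    cons (3 , 1) (vertex-i1 (s≤s z<s) 3≤D) (row-adj z<s 3≤D z<s 3≤D)
      (cons (3 , 2) (vertex-i2 ≤-refl 3≤D) (Adj-sameColumn (vertex-i2 ≤-refl 3≤D) vertex-12 (λ ()))
        (emptyPath vertex-12) λ { fzero () })
      λ { fzero () ; (fsuc fzero) () }

  dist-i1-12≤3 : ∀ i → 2 ≤ i → i ≤ D → DistLe D (i , 1) (1 , 2) 3
  dist-i1-12≤3 i 2≤i i≤D with i ≟ 3
  ... | yes refl = 2 , s≤s (s≤s z≤n) , path-31-to-12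
  ... | no i≢3 = 3 , ≤-refl ,
    cons (i , 1) (vertex-i1 2≤i i≤D) (Adj-sameColumn (vertex-i1 2≤i i≤D) (vertex-i1 (s≤s z<s) 3≤D) i≢3)
         path-31-to-12
         λ { fzero eq → i≢3 (sym (cong proj₁ eq)) ; (fsuc fzero) () ; (fsuc (fsuc fzero)) () }

  InS-diameter≤3 : ∀ s t → InS D s → InS D t → DistLe D s t 3
  InS-diameter≤3 _ _ (inj₁ refl) (inj₁ refl) = 0 , z≤n , emptyPath vertex-12
  InS-diameter≤3 _ _ (inj₁ refl) (inj₂ (i , (2≤i , i≤D) , refl)) = DistLe-sym (dist-i1-12≤3 i 2≤i i≤D)
  InS-diameter≤3 _ _ (inj₂ (i , (2≤i , i≤D) , refl)) (inj₁ refl) = dist-i1-12≤3 i 2≤i i≤D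
  InS-diameter≤3 _ _ (inj₂ (i , (2≤i , i≤D) , refl)) (inj₂ (j , (2≤j , j≤D) , refl)) with i ≟ j
  ... | yes refl = 0 , z≤n , emptyPath (vertex-i1 2≤i i≤D)
  ... | no i≢j = 1 , z<s ,
    cons (i , 1) (vertex-i1 2≤i i≤D) (Adj-sameColumn (vertex-i1 2≤i i≤D) (vertex-i1 2≤j j≤D) i≢j)
         (emptyPath (vertex-i1 2≤j j≤D)) λ { fzero eq → i≢j (sym (cong proj₁ eq)) }

lemma3p6 : ∀ (d : ℕ) → 3 ≤ d →
    ((∀ (i : ℕ) → 1 ≤ i → i ≤ d ∸ 1 → i ≢ 2 → Path d (d ∸ 2) (1 , 2) (i , d))
    × Path d (d ∸ 2) (1 , 2) (d , d ∸ 1))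
    × ((∀ (i : ℕ) → 2 ≤ i → i ≤ d ∸ 1 → Path d (d ∸ 2) (i , 1) (i , d))
    × Path d (d ∸ 2) (d , 1) (d , d ∸ 1))
    × (∀ (v : V) → IsVertex d v → ∃[ s ] (InS d s × DistLe d s v (d ∸ 2)))
    × (∀ (s t : V) → InS d s → InS d t → DistLe d s t 3)
lemma3p6 1 (s≤s ())
lemma3p6 2 (s≤s (s≤s ()))
lemma3p6 (suc (suc (suc e))) _ =
  (path-from-12-to-top , path-from-12-to-last-row) , (path-up-row , path-up-last-row) ,
  InS-dominating , InS-diameter≤3
  where open SiloGraph e
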